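{- Let $n\ge 4$ and $1\le k\le n$. Let $t=[t_1\cdots t_{n-1}]$ be an injective word of length $n-1$ in $[n]$ not containing the letter $k$, let $\rho(t)+1\le i\le n$ with $i\neq k$, and set $s=\sigma_i(t)$. Then $J_0(t)\cap[1,i-1]\neq\emptyset$, so we may set $b=\max(J_0(t)\cap[1,i-1])$ and $t'=\partial_b(s)$. Then $\rho(t)\le b\le i-1$, the word $t'$ does not contain the letter $b$, and $$J_1(t')=J_1(t)\cap\big([1,\min\{\lambda(t),b-1\}]\cup[i,\lambda(t)]\big).$$ Moreover: (i) if $b=\rho(t)$ then $\rho(t')>\rho(t)$ (possibly $\rho(t')=n$); (ii) if $b>\rho(t)$ then $\rho(t')=\rho(t)$ and $\overrightarrow{\delta}(J_0(t))<_L\overrightarrow{\delta}(J_0(t'))$.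
   Context: Intervals are in $\mathbb Z$. For an injective word $t$ of length $n-1$ missing letter $k$ and $1\le i\le n$, $\sigma_i(t)=[t_1\cdots t_{i-1}\,k\,t_i\cdots t_{n-1}]$. For a word $s$ of length $m$ and $1\le j\le m$, $\partial_j(s)$ is the word obtained by deleting the $j$-th letter. $J_0(t)=\{1\le j\le n-1:t_j=j\}$, $J_1(t)=\{1\le j\le n-1:t_j=j+1\}$, $\lambda(t)=\max(J_1(t)\cup\{0\})$, $\rho(t)=\min(J_0(t)\cup\{n\})$. For $J\subseteq\{1,\dots,n-1\}$, write $J\cup\{n\}=\{j_1<\dots<j_p<j_{p+1}=n\}$ and set $\overrightarrow{\delta}(J)=(j_2-j_1,\dots,j_{p+1}-j_p)$, a word in the alphabet $\{1,\dots,n-1\}$. $<_L$ is the strict lexicographic (left to right) order on the set of all finite words (including the empty word) in the alphabet $\{1,\dots,n-1\}$. -}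

module Defs where

open import Data.Nat using (ℕ; zero; suc; _∸_; _⊔_; _⊓_; _<_; _≟_; _<?_)
open import Data.List using (List; []; _∷_; _++_; take; drop; filter; map; upTo; foldr)
open import Data.List.Relation.Binary.Lex.Strict using (Lex-<)
open import Relation.Binary.PropositionalEquality using (_≡_)

-- Words are lists of naturals; letters/positions are 1-indexed as in the paper.

-- the j-th letter (1-indexed) of a word; 0 outside the range (never used there)
at : List ℕ → ℕ → ℕ
at []       _             = 0
at (x ∷ xs) zero          = 0
at (x ∷ xs) (suc zero)    = x
at (x ∷ xs) (suc (suc j)) = at xs (suc j)

-- σ_i(t) = [t_1 ⋯ t_{i-1} k t_i ⋯ t_{n-1}]  (k the missing letter, passed explicitly)
σ : ℕ → ℕ → List ℕ → List ℕ
σ k i t = take (i ∸ 1) t ++ (k ∷ drop (i ∸ 1) t)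

∂ : ℕ → List ℕ → List ℕ
∂ j s = take (j ∸ 1) s ++ drop j s

interval1 : ℕ → List ℕ
interval1 m = map suc (upTo m)

J₀ : ℕ → List ℕ → List ℕ
J₀ n t = filter (λ j → at t j ≟ j) (interval1 (n ∸ 1))

J₁ : ℕ → List ℕ → List ℕ
J₁ n t = filter (λ j → at t j ≟ suc j) (interval1 (n ∸ 1))

lam : ℕ → List ℕ → ℕ
lam n t = foldr _⊔_ 0 (J₁ n t)

rho : ℕ → List ℕ → ℕ
rho n t = foldr _⊓_ n (J₀ n t)

diffs : List ℕ → List ℕ
diffs []               = []
diffs (x ∷ [])         = []
diffs (x ∷ y ∷ rest)   = (y ∸ x) ∷ diffs (y ∷ rest)

δ→ : ℕ → List ℕ → List ℕ
δ→ n J = diffs (J ++ (n ∷ []))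

-- strict lexicographic order on finite words (proper prefix is smaller)
_<L_ : List ℕ → List ℕ → Set
_<L_ = Lex-< _≡_ _<_

-- b = max (J_0(t) ∩ [1, i-1])  (0 if empty)
bOf : ℕ → ℕ → List ℕ → ℕ
bOf n i t = foldr _⊔_ 0 (filter (λ j → j <? i) (J₀ n t))

-- Position by position, t′ = ∂_b (σ_i t) agrees with t below b and from i on, carries the inserted
-- letter k ≠ i at position i − 1, and carries t_{j+1} at each position j ∈ [b, i − 2]. As b is the
-- last fixed point of t before i, no such j has t_{j+1} = j + 1, so J₁(t′) keeps exactly the part of
-- J₁(t) outside [b, i − 1]. As t′ is injective and has lost the letter b, J₀(t′) agrees with J₀(t)
-- below b, misses b, and lies above b otherwise; this gives the claims on ρ, and δ→(J₀) increases
-- because the gap following the last fixed point below b (there is one when ρ < b) grows.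
module Submission where

open import Defs
open import Data.Nat using (ℕ; zero; suc; _≤_; _<_; _∸_; _⊓_; _⊔_; z≤n; s≤s; s≤s⁻¹; >-nonZero)
open import Data.Nat.Properties
open import Data.List using (List; []; _∷_; _++_; [_]; length; filter; foldr)
open import Data.List.Properties using (filter-++; filter-accept; filter-reject; ++-assoc; foldr-preservesᵇ)
open import Data.List.Membership.Propositional using (_∈_; _∉_)
open import Data.List.Membership.Propositional.Properties using (∈-filter⁺; ∈-filter⁻; ∈-map⁺; ∈-map⁻; ∈-upTo⁺; ∈-upTo⁻; ∈-++⁻; foldr-selective)
open import Data.List.Relation.Unary.Any using (here; there)
open import Data.List.Relation.Unary.All as All using (All; []; _∷_)
open import Data.List.Relation.Unary.All.Properties using (¬Any⇒All¬; All¬⇒¬Any; take⁺; drop⁺; ++⁺; filter⁺)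
open import Data.List.Relation.Unary.AllPairs using (AllPairs; []; _∷_)
import Data.List.Relation.Unary.AllPairs.Properties as AllPairs
open import Data.List.Relation.Unary.Unique.Propositional using (Unique)
open import Data.List.Relation.Binary.Lex.Strict using (this; next)
open import Data.Product using (_×_; _,_; ∃-syntax; ∃₂; proj₁; proj₂)
open import Data.Sum using (_⊎_; inj₁; inj₂)
open import Data.Empty using (⊥-elim)
open import Function using (_∘_)
open import Function.Bundles using (_⇔_; mk⇔; Equivalence)
open import Relation.Nullary using (yes; no)
open import Relation.Unary using (Pred; Decidable)
open import Relation.Binary using (tri<; tri≈; tri>)
open import Relation.Binary.PropositionalEquality using (_≡_; _≢_; refl; sym; trans; cong; subst; subst₂; cong₂)

at-zero : ∀ xs → at xs 0 ≡ 0
at-zero []       = refl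
at-zero (x ∷ xs) = refl

at-∈ : ∀ xs j → at xs j ≢ 0 → at xs j ∈ xs
at-∈ []       j             nz = ⊥-elim (nz refl)
at-∈ (x ∷ xs) zero          nz = ⊥-elim (nz refl)
at-∈ (x ∷ xs) (suc zero)    nz = here refl
at-∈ (x ∷ xs) (suc (suc j)) nz = there (at-∈ xs (suc j) nz)

at-∂-< : ∀ b s {j} → j < b → at (∂ b s) j ≡ at s j
at-∂-< b              s        {zero}        _ = trans (at-zero (∂ b s)) (sym (at-zero s))
at-∂-< (suc zero)     s        {suc j}       (s≤s ())
at-∂-< (suc (suc b))  []       {suc j}       _ = refl
at-∂-< (suc (suc b))  (x ∷ s)  {suc zero}    _ = refl
at-∂-< (suc (suc b))  (x ∷ s)  {suc (suc j)} (s≤s j<b) = at-∂-< (suc b) s j<b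

at-∂-≥ : ∀ b s {j} → 1 ≤ b → b ≤ j → at (∂ b s) j ≡ at s (suc j)
at-∂-≥ (suc zero)    []      {suc j}       _ _ = refl
at-∂-≥ (suc zero)    (x ∷ s) {suc j}       _ _ = refl
at-∂-≥ (suc (suc b)) s       {suc zero}    _ (s≤s ())
at-∂-≥ (suc (suc b)) []      {suc (suc j)} _ _ = refl
at-∂-≥ (suc (suc b)) (x ∷ s) {suc (suc j)} _ (s≤s b≤j) = at-∂-≥ (suc b) s (s≤s z≤n) b≤j

at-σ-< : ∀ k i t {j} → i ≤ suc (length t) → j < i → at (σ k i t) j ≡ at t j
at-σ-< k i             t       {zero}        _ _ = trans (at-zero (σ k i t)) (sym (at-zero t))
at-σ-< k (suc zero)    t       {suc j}       _ (s≤s ())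
at-σ-< k (suc (suc i)) []      {suc j}       (s≤s ()) _
at-σ-< k (suc (suc i)) (x ∷ t) {suc zero}    _ _ = refl
at-σ-< k (suc (suc i)) (x ∷ t) {suc (suc j)} (s≤s i≤) (s≤s j<i) = at-σ-< k (suc i) t i≤ j<i

at-σ-≡ : ∀ k i t → 1 ≤ i → i ≤ suc (length t) → at (σ k i t) i ≡ k
at-σ-≡ k (suc zero)    t       _ _ = refl
at-σ-≡ k (suc (suc i)) []      _ (s≤s ())
at-σ-≡ k (suc (suc i)) (x ∷ t) _ (s≤s i≤) = at-σ-≡ k (suc i) t (s≤s z≤n) i≤

at-σ-> : ∀ k i t {j} → 1 ≤ i → i ≤ j → at (σ k i t) (suc j) ≡ at t j
at-σ-> k (suc zero)    t       {suc j}       _ _ = refl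
at-σ-> k (suc (suc i)) t       {suc zero}    _ (s≤s ())
at-σ-> k (suc (suc i)) []      {suc (suc j)} _ _ = refl
at-σ-> k (suc (suc i)) (x ∷ t) {suc (suc j)} _ (s≤s i≤j) = at-σ-> k (suc i) t (s≤s z≤n) i≤j

All-σ : ∀ {p} {P : Pred ℕ p} k i t → P k → All P t → All P (σ k i t)
All-σ k i t pk pt = ++⁺ (take⁺ (i ∸ 1) pt) (pk ∷ drop⁺ (i ∸ 1) pt)

Unique-σ : ∀ k i {t} → k ∉ t → Unique t → Unique (σ k i t)
Unique-σ k zero          {t}     k∉t u = ¬Any⇒All¬ t k∉t ∷ u
Unique-σ k (suc zero)    {t}     k∉t u = ¬Any⇒All¬ t k∉t ∷ u
Unique-σ k (suc (suc i)) {[]}    k∉t u = [] ∷ []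
Unique-σ k (suc (suc i)) {x ∷ t} k∉t (x∉t ∷ u) =
  All-σ k (suc i) t (λ x≡k → k∉t (here (sym x≡k))) x∉t ∷ Unique-σ k (suc i) (k∉t ∘ there) u

∉-∂ : ∀ {s} j → Unique s → at s j ≢ 0 → at s j ∉ ∂ j s
∉-∂ {[]}    j             _          nz = ⊥-elim (nz refl)
∉-∂ {x ∷ s} zero          _          nz = ⊥-elim (nz refl)
∉-∂ {x ∷ s} (suc zero)    (x∉s ∷ _)  _  = All¬⇒¬Any x∉s
∉-∂ {x ∷ s} (suc (suc j)) (x∉s ∷ _)  nz (here y≡x) = All.lookup x∉s (at-∈ s (suc j) nz) (sym y≡x)
∉-∂ {x ∷ s} (suc (suc j)) (_ ∷ u)    nz (there y∈) = ∉-∂ (suc j) u nz y∈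

foldr-⊓-≤ : ∀ {x} e xs → x ∈ xs → foldr _⊓_ e xs ≤ x
foldr-⊓-≤ e (y ∷ xs) (here refl) = m⊓n≤m y _
foldr-⊓-≤ e (y ∷ xs) (there x∈) = ≤-trans (m⊓n≤n y _) (foldr-⊓-≤ e xs x∈)

foldr-⊔-≥ : ∀ {x} e xs → x ∈ xs → x ≤ foldr _⊔_ e xs
foldr-⊔-≥ e (y ∷ xs) (here refl) = m≤m⊔n y _
foldr-⊔-≥ e (y ∷ xs) (there x∈) = ≤-trans (foldr-⊔-≥ e xs x∈) (m≤n⊔m y _)

foldr-⊓-glb : ∀ {m} e xs → m ≤ e → (∀ {x} → x ∈ xs → m ≤ x) → m ≤ foldr _⊓_ e xs
foldr-⊓-glb e xs m≤e m≤xs = foldr-preservesᵇ ⊓-glb m≤e (All.tabulate m≤xs)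

foldr-⊓-∈ : ∀ e xs → foldr _⊓_ e xs < e → foldr _⊓_ e xs ∈ xs
foldr-⊓-∈ e xs lt with foldr-selective ⊓-sel e xs
... | inj₁ eq = ⊥-elim (<-irrefl eq lt)
... | inj₂ x∈ = x∈

max-below : ∀ {i x} xs → x ∈ xs → 1 ≤ x → x < i →
  let m = foldr _⊔_ 0 (filter (_<? i) xs) in
  (m ∈ xs × m < i) × (∀ {j} → j ∈ xs → j < i → j ≤ m)
max-below {i} xs x∈ 1≤x x<i = ∈-filter⁻ (_<? i) max∈ , bound
  where
  bound : ∀ {j} → j ∈ xs → j < i → j ≤ foldr _⊔_ 0 (filter (_<? i) xs)
  bound j∈ j<i = foldr-⊔-≥ 0 _ (∈-filter⁺ (_<? i) j∈ j<i)
  max∈ : foldr _⊔_ 0 (filter (_<? i) xs) ∈ filter (_<? i) xs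
  max∈ with foldr-selective ⊔-sel 0 (filter (_<? i) xs)
  ... | inj₁ max≡0 = ⊥-elim (<⇒≱ 1≤x (subst (_ ≤_) max≡0 (bound x∈ x<i)))
  ... | inj₂ max∈ = max∈

∈-interval1⁻ : ∀ {x m} → x ∈ interval1 m → 1 ≤ x × x ≤ m
∈-interval1⁻ x∈ with ∈-map⁻ suc x∈
... | _ , q∈ , refl = s≤s z≤n , ∈-upTo⁻ q∈

∈-interval1⁺ : ∀ {x m} → 1 ≤ x → x ≤ m → x ∈ interval1 m
∈-interval1⁺ {suc q} _ q<m = ∈-map⁺ suc (∈-upTo⁺ q<m)

interval1-sorted : ∀ m → AllPairs _<_ (interval1 m)
interval1-sorted m = AllPairs.map⁺ (AllPairs.applyUpTo⁺₁ (λ x → x) m (λ i<j _ → s≤s i<j))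

split-sorted : ∀ {b xs} → AllPairs _<_ xs → b ∈ xs →
  ∃₂ λ ys zs → xs ≡ ys ++ b ∷ zs × All (_< b) ys × All (b <_) zs
split-sorted {xs = x ∷ xs} (x< ∷ _) (here refl) = [] , xs , refl , [] , x<
split-sorted {xs = x ∷ xs} (x< ∷ sorted) (there b∈) with split-sorted sorted b∈
... | ys , zs , refl , ys<b , b<zs = x ∷ ys , zs , refl , All.lookup x< b∈ ∷ ys<b , b<zs

filter-cong : ∀ {p q} {P : Pred ℕ p} {Q : Pred ℕ q} (P? : Decidable P) (Q? : Decidable Q) {xs} →
  All (λ x → P x ⇔ Q x) xs → filter P? xs ≡ filter Q? xs
filter-cong P? Q? {[]} [] = refl
filter-cong P? Q? {x ∷ xs} (Px⇔Qx ∷ eqs) with P? x | Q? x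
... | yes px | yes qx = cong (x ∷_) (filter-cong P? Q? eqs)
... | yes px | no ¬qx = ⊥-elim (¬qx (Equivalence.to Px⇔Qx px))
... | no ¬px | yes qx = ⊥-elim (¬px (Equivalence.from Px⇔Qx qx))
... | no ¬px | no ¬qx = filter-cong P? Q? eqs

diffs-<L : ∀ p P {x y} X Y → All (_≤ x) (p ∷ P) → x < y → diffs (p ∷ P ++ x ∷ X) <L diffs (p ∷ P ++ y ∷ Y)
diffs-<L p []      X Y (p≤x ∷ []) x<y = this (∸-monoˡ-< x<y p≤x)
diffs-<L p (q ∷ P) X Y (_ ∷ ≤x)    x<y = next refl (diffs-<L q P X Y ≤x x<y)

δ→-<L-remove : ∀ {n b x} F Z Z′ → x ∈ F → All (_< b) F → All (b <_) Z′ → b < n →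
  δ→ n (F ++ b ∷ Z) <L δ→ n (F ++ Z′)
δ→-<L-remove {n} {b} (f ∷ F) Z Z′ _ F<b b<Z′ b<n
  rewrite ++-assoc F (b ∷ Z) [ n ] | ++-assoc F Z′ [ n ] with Z′ | b<Z′
... | []     | []      = diffs-<L f F _ _ (All.map <⇒≤ F<b) b<n
... | e ∷ Y  | b<e ∷ _ = diffs-<L f F _ _ (All.map <⇒≤ F<b) b<e

∈-J₀⁻ : ∀ n t {j} → j ∈ J₀ n t → j ∈ interval1 (n ∸ 1) × at t j ≡ j
∈-J₀⁻ n t = ∈-filter⁻ (λ j → at t j ≟ j) {xs = interval1 (n ∸ 1)}

∈-J₀⁺ : ∀ n t {j} → j ∈ interval1 (n ∸ 1) → at t j ≡ j → j ∈ J₀ n t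
∈-J₀⁺ n t = ∈-filter⁺ (λ j → at t j ≟ j)

∈-J₁⁻ : ∀ n t {j} → j ∈ J₁ n t → j ∈ interval1 (n ∸ 1) × at t j ≡ suc j
∈-J₁⁻ n t = ∈-filter⁻ (λ j → at t j ≟ suc j) {xs = interval1 (n ∸ 1)}

∈-J₁⁺ : ∀ n t {j} → j ∈ interval1 (n ∸ 1) → at t j ≡ suc j → j ∈ J₁ n t
∈-J₁⁺ n t = ∈-filter⁺ (λ j → at t j ≟ suc j)

J₀-positive : ∀ n t {j} → j ∈ J₀ n t → 1 ≤ j
J₀-positive n t j∈ = proj₁ (∈-interval1⁻ (proj₁ (∈-J₀⁻ n t j∈)))

rho-∈-J₀ : ∀ n t → rho n t < n → rho n t ∈ J₀ n t
rho-∈-J₀ n t = foldr-⊓-∈ n (J₀ n t)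

rho-≤ : ∀ n t {j} → j ∈ J₀ n t → rho n t ≤ j
rho-≤ n t = foldr-⊓-≤ n (J₀ n t)

module DeleteAfterInsert {n k i b : ℕ} {t : List ℕ}
  (len : length t ≡ n ∸ 1) (uniq : Unique t) (k∉t : k ∉ t) (i≤n : i ≤ n) (i≢k : i ≢ k)
  (b∈J₀ : b ∈ J₀ n t) (b<i : b < i) (b-max : ∀ {j} → j ∈ J₀ n t → j < i → j ≤ b)
  where

  private
    t′ : List ℕ
    t′ = ∂ b (σ k i t)

    1≤b : 1 ≤ b
    1≤b = J₀-positive n t b∈J₀

    1≤i : 1 ≤ i
    1≤i = ≤-trans 1≤b (<⇒≤ b<i)

    b<n : b < n
    b<n = <-≤-trans b<i i≤n

    b≢0 : b ≢ 0
    b≢0 = >⇒≢ 1≤b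

    tb≡b : at t b ≡ b
    tb≡b = proj₂ (∈-J₀⁻ n t b∈J₀)

    i≤1+len : i ≤ suc (length t)
    i≤1+len = subst (λ m → i ≤ suc m) (sym len) (≤-trans i≤n (m≤n+m∸n n 1))

  data Region (j : ℕ) : Set where
    before   : j < b → Region j
    shifted  : b ≤ j → suc j < i → Region j
    inserted : suc j ≡ i → Region j
    after    : i ≤ j → Region j

  region : ∀ j → Region j
  region j with <-cmp j b | <-cmp (suc j) i
  ... | tri< j<b _ _ | _              = before j<b
  ... | tri≈ _ j≡b _ | tri< sj<i _ _ = shifted (≤-reflexive (sym j≡b)) sj<i
  ... | tri> _ _ b<j | tri< sj<i _ _ = shifted (<⇒≤ b<j) sj<i
  ... | _            | tri≈ _ sj≡i _ = inserted sj≡i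
  ... | _            | tri> _ _ i<sj = after (s≤s⁻¹ i<sj)

  letter-before : ∀ {j} → j < b → at t′ j ≡ at t j
  letter-before j<b = trans (at-∂-< b (σ k i t) j<b) (at-σ-< k i t i≤1+len (<-trans j<b b<i))

  letter-shifted : ∀ {j} → b ≤ j → suc j < i → at t′ j ≡ at t (suc j)
  letter-shifted b≤j sj<i = trans (at-∂-≥ b (σ k i t) 1≤b b≤j) (at-σ-< k i t i≤1+len sj<i)

  letter-inserted : ∀ {j} → suc j ≡ i → at t′ j ≡ k
  letter-inserted {j} refl = trans (at-∂-≥ b (σ k i t) 1≤b (s≤s⁻¹ b<i)) (at-σ-≡ k (suc j) t 1≤i i≤1+len)

  letter-after : ∀ {j} → i ≤ j → at t′ j ≡ at t j
  letter-after i≤j = trans (at-∂-≥ b (σ k i t) 1≤b (≤-trans (<⇒≤ b<i) i≤j)) (at-σ-> k i t 1≤i i≤j)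

  b∉∂σ : b ∉ t′
  b∉∂σ = subst (_∉ t′) σb≡b (∉-∂ b (Unique-σ k i k∉t uniq) (subst (_≢ 0) (sym σb≡b) b≢0))
    where
    σb≡b : at (σ k i t) b ≡ b
    σb≡b = trans (at-σ-< k i t i≤1+len b<i) tb≡b

  b∉J₀-∂σ : b ∉ J₀ n t′
  b∉J₀-∂σ b∈ = b∉∂σ (subst (_∈ t′) t′b≡b (at-∈ t′ b (subst (_≢ 0) (sym t′b≡b) b≢0)))
    where
    t′b≡b : at t′ b ≡ b
    t′b≡b = proj₂ (∈-J₀⁻ n t′ b∈)

  J₀-∂σ-below : ∀ {j} → j < b → j ∈ J₀ n t′ ⇔ j ∈ J₀ n t
  J₀-∂σ-below j<b = mk⇔
    (λ j∈ → let j∈I , e = ∈-J₀⁻ n t′ j∈ in ∈-J₀⁺ n t j∈I (trans (sym (letter-before j<b)) e))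
    (λ j∈ → let j∈I , e = ∈-J₀⁻ n t j∈ in ∈-J₀⁺ n t′ j∈I (trans (letter-before j<b) e))

  J₁-∂σ : ∀ j → j ∈ J₁ n t′ ⇔ (j ∈ J₁ n t × ((1 ≤ j × j ≤ lam n t ⊓ (b ∸ 1)) ⊎ (i ≤ j × j ≤ lam n t)))
  J₁-∂σ j = mk⇔ to from
    where
    to : j ∈ J₁ n t′ → j ∈ J₁ n t × ((1 ≤ j × j ≤ lam n t ⊓ (b ∸ 1)) ⊎ (i ≤ j × j ≤ lam n t))
    to j∈ with ∈-J₁⁻ n t′ j∈ | region j
    ... | j∈I , e | before j<b =
      let j∈J₁ = ∈-J₁⁺ n t j∈I (trans (sym (letter-before j<b)) e)
      in j∈J₁ , inj₁ (proj₁ (∈-interval1⁻ j∈I) , ⊓-glb (foldr-⊔-≥ 0 _ j∈J₁) (<⇒≤pred j<b))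
    ... | j∈I , e | shifted b≤j sj<i =
      let sj∈J₀ = ∈-J₀⁺ n t (∈-interval1⁺ (s≤s z≤n) (<⇒≤pred (<-≤-trans sj<i i≤n)))
                             (trans (sym (letter-shifted b≤j sj<i)) e)
      in ⊥-elim (<⇒≱ (b-max sj∈J₀ sj<i) b≤j)
    ... | j∈I , e | inserted sj≡i = ⊥-elim (i≢k (trans (sym sj≡i) (trans (sym e) (letter-inserted sj≡i))))
    ... | j∈I , e | after i≤j =
      let j∈J₁ = ∈-J₁⁺ n t j∈I (trans (sym (letter-after i≤j)) e)
      in j∈J₁ , inj₂ (i≤j , foldr-⊔-≥ 0 _ j∈J₁)
    from : j ∈ J₁ n t × ((1 ≤ j × j ≤ lam n t ⊓ (b ∸ 1)) ⊎ (i ≤ j × j ≤ lam n t)) → j ∈ J₁ n t′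
    from (j∈ , inj₁ (_ , j≤)) =
      let j∈I , e = ∈-J₁⁻ n t j∈
          j<b = m≤pred[n]⇒suc[m]≤n {{>-nonZero 1≤b}} (m≤n⊓o⇒m≤o (lam n t) _ j≤)
      in ∈-J₁⁺ n t′ j∈I (trans (letter-before j<b) e)
    from (j∈ , inj₂ (i≤j , _)) =
      let j∈I , e = ∈-J₁⁻ n t j∈ in ∈-J₁⁺ n t′ j∈I (trans (letter-after i≤j) e)

  J₀-∂σ-split : ∀ {j} → j ∈ J₀ n t′ → (j < b × j ∈ J₀ n t) ⊎ b < j
  J₀-∂σ-split {j} j∈ with <-cmp j b
  ... | tri< j<b _ _ = inj₁ (j<b , Equivalence.to (J₀-∂σ-below j<b) j∈)
  ... | tri≈ _ refl _ = ⊥-elim (b∉J₀-∂σ j∈)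
  ... | tri> _ _ b<j = inj₂ b<j

  rho-∂σ-> : b ≡ rho n t → rho n t < rho n t′
  rho-∂σ-> b≡ρ = foldr-⊓-glb n (J₀ n t′) (subst (_< n) b≡ρ b<n) above-ρ
    where
    above-ρ : ∀ {j} → j ∈ J₀ n t′ → rho n t < j
    above-ρ j∈ with J₀-∂σ-split j∈
    ... | inj₁ (j<b , j∈J₀) = ⊥-elim (<⇒≱ (subst (_ <_) b≡ρ j<b) (rho-≤ n t j∈J₀))
    ... | inj₂ b<j = subst (_< _) b≡ρ b<j

  rho-∂σ-≡ : rho n t < b → rho n t′ ≡ rho n t
  rho-∂σ-≡ ρ<b = ≤-antisym (rho-≤ n t′ ρ∈J₀′) (foldr-⊓-glb n (J₀ n t′) (<⇒≤ (<-trans ρ<b b<n)) above-ρ)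
    where
    ρ∈J₀′ : rho n t ∈ J₀ n t′
    ρ∈J₀′ = Equivalence.from (J₀-∂σ-below ρ<b) (rho-∈-J₀ n t (<-trans ρ<b b<n))
    above-ρ : ∀ {j} → j ∈ J₀ n t′ → rho n t ≤ j
    above-ρ j∈ with J₀-∂σ-split j∈
    ... | inj₁ (_ , j∈J₀) = rho-≤ n t j∈J₀
    ... | inj₂ b<j = <⇒≤ (<-trans ρ<b b<j)

  δ→-J₀-∂σ : rho n t < b → δ→ n (J₀ n t) <L δ→ n (J₀ n t′)
  δ→-J₀-∂σ ρ<b with split-sorted (interval1-sorted (n ∸ 1)) (proj₁ (∈-J₀⁻ n t b∈J₀))
  ... | ys , zs , I≡ , ys<b , b<zs =
    subst₂ (λ U V → δ→ n U <L δ→ n V) (sym J₀≡) (sym J₀′≡)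
      (δ→-<L-remove (filter P? ys) (filter P? zs) (filter Q? zs) ρ∈ (filter⁺ P? ys<b) (filter⁺ Q? b<zs) b<n)
    where
    P? = λ j → at t j ≟ j
    Q? = λ j → at t′ j ≟ j
    ρ∈J₀ : rho n t ∈ J₀ n t
    ρ∈J₀ = rho-∈-J₀ n t (<-trans ρ<b b<n)
    ρ∈ys : rho n t ∈ ys
    ρ∈ys with ∈-++⁻ ys (subst (rho n t ∈_) I≡ (proj₁ (∈-J₀⁻ n t ρ∈J₀)))
    ... | inj₁ ρ∈ = ρ∈
    ... | inj₂ (here ρ≡b) = ⊥-elim (<-irrefl ρ≡b ρ<b)
    ... | inj₂ (there ρ∈zs) = ⊥-elim (<-asym ρ<b (All.lookup b<zs ρ∈zs))
    ρ∈ : rho n t ∈ filter P? ys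
    ρ∈ = ∈-filter⁺ P? ρ∈ys (proj₂ (∈-J₀⁻ n t ρ∈J₀))
    t′b≢b : at t′ b ≢ b
    t′b≢b e = b∉J₀-∂σ (∈-J₀⁺ n t′ (proj₁ (∈-J₀⁻ n t b∈J₀)) e)
    J₀≡ : J₀ n t ≡ filter P? ys ++ b ∷ filter P? zs
    J₀≡ = trans (cong (filter P?) I≡) (trans (filter-++ P? ys _) (cong (filter P? ys ++_) (filter-accept P? tb≡b)))
    J₀′≡ : J₀ n t′ ≡ filter P? ys ++ filter Q? zs
    J₀′≡ = trans (cong (filter Q?) I≡) (trans (filter-++ Q? ys _)
      (cong₂ _++_ (sym (filter-cong P? Q? (All.map agree ys<b))) (filter-reject Q? t′b≢b)))
      where
      agree : ∀ {x} → x < b → (at t x ≡ x) ⇔ (at t′ x ≡ x)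
      agree x<b = mk⇔ (trans (letter-before x<b)) (trans (sym (letter-before x<b)))

lemma4p16 : (n k i : ℕ) (t : List ℕ) →
    4 ≤ n → 1 ≤ k → k ≤ n →
    length t ≡ n ∸ 1 → All (λ x → 1 ≤ x × x ≤ n) t → Unique t → k ∉ t →
    rho n t < i → i ≤ n → i ≢ k →
    (∃[ j ] (j ∈ J₀ n t × j < i))
    × (rho n t ≤ bOf n i t)
    × (bOf n i t ≤ i ∸ 1)
    × (bOf n i t ∉ ∂ (bOf n i t) (σ k i t))
    × (∀ j → j ∈ J₁ n (∂ (bOf n i t) (σ k i t))
             ⇔ (j ∈ J₁ n t × (  (1 ≤ j × j ≤ lam n t ⊓ (bOf n i t ∸ 1))
                              ⊎ (i ≤ j × j ≤ lam n t))))
    × (bOf n i t ≡ rho n t → rho n t < rho n (∂ (bOf n i t) (σ k i t)))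
    × (rho n t < bOf n i t →
         rho n (∂ (bOf n i t) (σ k i t)) ≡ rho n t
         × δ→ n (J₀ n t) <L δ→ n (J₀ n (∂ (bOf n i t) (σ k i t))))
lemma4p16 n k i t _ _ _ len _ uniq k∉t ρ<i i≤n i≢k
  with ρ∈J₀ ← rho-∈-J₀ n t (<-≤-trans ρ<i i≤n)
  with (b∈J₀ , b<i) , b-max ← max-below (J₀ n t) ρ∈J₀ (J₀-positive n t ρ∈J₀) ρ<i
  = (rho n t , ρ∈J₀ , ρ<i) , b-max ρ∈J₀ ρ<i , <⇒≤pred b<i , b∉∂σ , J₁-∂σ , rho-∂σ-> ,
    λ ρ<b → rho-∂σ-≡ ρ<b , δ→-J₀-∂σ ρ<b
  where open DeleteAfterInsert len uniq k∉t i≤n i≢k b∈J₀ b<i b-max
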